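{- Let $k,n$ be positive integers with $n\ge k>1$. If there exists a prime $p$ such that $\frac{n}{k+4}<p\le \frac{n}{k}$, $p>k+4$, and $p\nmid 3k+8$, then $S(k,n)$ is not an integer.
   Context: For positive integers $k\le n$, $S(k,n)$ denotes the $k$-th elementary symmetric function of $1, 1/2, \ldots, 1/n$, i.e. $S(k,n)=\sum_{1\le i_1<i_2<\cdots<i_k\le n}\frac{1}{i_1 i_2\cdots i_k}$. -}

module Defs where

open import Data.Nat using (ℕ; zero; suc)
open import Data.Integer using (+_)
open import Data.Rational using (ℚ; 0ℚ; 1ℚ; _+_; _*_; _/_)

-- S k n = k-th elementary symmetric function of 1, 1/2, ..., 1/n
-- (e_0 = 1, e_k of the empty family = 0 for k > 0), via the recursion
-- e_{k+1}(x_1..x_{n+1}) = e_{k+1}(x_1..x_n) + x_{n+1} * e_k(x_1..x_n).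
S : ℕ → ℕ → ℚ
S zero    n       = 1ℚ
S (suc k) zero    = 0ℚ
S (suc k) (suc n) = S (suc k) n + (+ 1 / suc n) * S k n

_/ℕ_ : ℕ → (m : ℕ) → .{{_ : Data.Nat.NonZero m}} → ℚ
n /ℕ m = + n / m

IsInteger : ℚ → Set
IsInteger q = Σ ℤ (λ z → q ≡ z / 1)
  where open import Data.Integer using (ℤ)
        open import Data.Product using (Σ)
        open import Relation.Binary.PropositionalEquality using (_≡_)

open import Data.Nat using (_<_; >-nonZero; s≤s; z≤n)
open import Data.Nat.Properties using (<-trans)
divBy : ℕ → (k : ℕ) → 1 < k → ℚ
divBy n k k>1 = _/ℕ_ n k ⦃ >-nonZero (<-trans (s≤s z≤n) k>1) ⦄

module Submission where

-- Write E j n = n! · S(j,n), a natural number (the coefficient of x^j in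
-- (x+1)(x+2)⋯(x+n)), so that E 0 n = n! and
--   E (j+1) (n+1) = (n+1) · E (j+1) n + E j n.
--
-- 1. p-adic expansion.  For a prime p and n = r + m·p with r < p there is a
--    unit A (p ∤ A) with E j n ≡ p^(m-j) · E j m · A  (mod p^(m-j+1)) for all
--    j ≤ m.  Induction along n: a step r ↦ r+1 multiplies A by r+1, a carry
--    (m, p-1) ↦ (m+1, 0) reproduces the recursion of E at m+1.
-- 2. Since p^m ∣ n!, for 1 ≤ k ≤ m the divisibility n! ∣ E k n forces p ∣ E k m.
-- 3. Closed forms of E k (k+d) for d < 4 show p ∤ E k m whenever k ≤ m < k+4,
--    p > k+4 and p ∤ 3k+8.
-- 4. In ℚ, S(k,n) = E k n / n!, so an integral S(k,n) gives n! ∣ E k n, while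
--    n/(k+4) < p ≤ n/k places m = ⌊n/p⌋ in [k, k+4).  Steps 2 and 3 then clash.

open import Defs
open import Data.Nat using (ℕ; _≤_; _<_; _+_; _*_)
open import Data.Nat.Divisibility using (_∣_)
open import Data.Nat.Primality using (Prime)
open import Data.Rational using (ℚ) renaming (_<_ to _<ℚ_; _≤_ to _≤ℚ_)
open import Data.Product using (Σ; _×_)
open import Relation.Nullary using (¬_)

open import Data.Nat using (zero; suc; _∸_; _^_; z≤n; s≤s; NonZero; nonTrivial⇒n>1)
open import Data.Nat.Properties
open import Data.Nat.Divisibility
  using (divides; ∣-trans; n∣m*n; ∣n⇒∣m*n; ∣m+n∣m⇒∣n; *-cancelˡ-∣; >⇒∤)
open import Data.Nat.DivMod using (_/_; _%_; m≡m%n+[m/n]*n; m%n<n; /-monoˡ-≤; m*n/n≡m; m<n*o⇒m/o<n)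
open import Data.Nat.Primality using (euclidsLemma; prime⇒nonTrivial)
open import Data.Nat.Tactic.RingSolver using (solve-∀)
open import Algebra.Properties.CommutativeSemigroup *-commutativeSemigroup using (x∙yz≈y∙xz)
open import Data.Product using (_,_; proj₁; proj₂)
open import Data.Sum using (inj₁; inj₂; [_,_]′)
open import Relation.Binary.PropositionalEquality
open ≡-Reasoning

open import Data.Integer as ℤ using (+_)
import Data.Integer.Properties as ℤ
import Data.Rational as ℚ
import Data.Rational.Properties as ℚ
open import Data.Rational.Unnormalised as ℚᵘ using (ℚᵘ; mkℚᵘ; *≡*; *<*; *≤*; _≃_)
import Data.Rational.Unnormalised.Properties as ℚᵘ

-- E j n = n! · S(j,n), defined by the recursion of S multiplied through by n!.
E : ℕ → ℕ → ℕ
E zero    zero    = 1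
E zero    (suc n) = suc n * E zero n
E (suc j) zero    = 0
E (suc j) (suc n) = suc n * E (suc j) n + E j n

E-above : ∀ {j n} → n < j → E j n ≡ 0
E-above {suc j} {zero}  _         = refl
E-above {suc j} {suc n} (s≤s n<j) = begin
  suc n * E (suc j) n + E j n ≡⟨ cong₂ (λ a b → suc n * a + b) (E-above (m<n⇒m<1+n n<j)) (E-above n<j) ⟩
  suc n * 0 + 0               ≡⟨ cong (_+ 0) (*-zeroʳ (suc n)) ⟩
  0                           ∎

E-diag : ∀ k → E k k ≡ 1
E-diag zero    = refl
E-diag (suc k) = begin
  suc k * E (suc k) k + E k k ≡⟨ cong₂ (λ a b → suc k * a + b) (E-above (n<1+n k)) (E-diag k) ⟩
  suc k * 0 + 1               ≡⟨ cong (_+ 1) (*-zeroʳ (suc k)) ⟩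
  1                           ∎

-- The next three diagonals in closed form.  Apart from 3k + 8, every factor
-- on the right lies between k + 1 and k + 4.
E-diag+1 : ∀ k → 2 * E k (1 + k) ≡ (1 + k) * (2 + k)
E-diag+1 zero    = refl
E-diag+1 (suc k) = begin
  2 * ((2 + k) * E (1 + k) (1 + k) + E k (1 + k))     ≡⟨ regroup k (E (1 + k) (1 + k)) (E k (1 + k)) ⟩
  (2 + k) * E (1 + k) (1 + k) * 2 + 2 * E k (1 + k)   ≡⟨ cong₂ (λ a b → (2 + k) * a * 2 + b) (E-diag (suc k)) (E-diag+1 k) ⟩
  (2 + k) * 1 * 2 + (1 + k) * (2 + k)                 ≡⟨ close k ⟩
  (2 + k) * (3 + k)                                   ∎
  where
  regroup : ∀ k X Y → 2 * ((2 + k) * X + Y) ≡ (2 + k) * X * 2 + 2 * Y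
  regroup = solve-∀
  close : ∀ k → (2 + k) * 1 * 2 + (1 + k) * (2 + k) ≡ (2 + k) * (3 + k)
  close = solve-∀

E-diag+2 : ∀ k → 24 * E k (2 + k) ≡ (1 + k) * (2 + k) * (3 + k) * (3 * k + 8)
E-diag+2 zero    = refl
E-diag+2 (suc k) = begin
  24 * ((3 + k) * E (1 + k) (2 + k) + E k (2 + k))           ≡⟨ regroup k (E (1 + k) (2 + k)) (E k (2 + k)) ⟩
  (3 + k) * 12 * (2 * E (1 + k) (2 + k)) + 24 * E k (2 + k)  ≡⟨ cong₂ (λ a b → (3 + k) * 12 * a + b) (E-diag+1 (suc k)) (E-diag+2 k) ⟩
  (3 + k) * 12 * ((2 + k) * (3 + k)) + (1 + k) * (2 + k) * (3 + k) * (3 * k + 8)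
                                                             ≡⟨ close k ⟩
  (2 + k) * (3 + k) * (4 + k) * (3 * (1 + k) + 8)            ∎
  where
  regroup : ∀ k X Y → 24 * ((3 + k) * X + Y) ≡ (3 + k) * 12 * (2 * X) + 24 * Y
  regroup = solve-∀
  close : ∀ k → (3 + k) * 12 * ((2 + k) * (3 + k)) + (1 + k) * (2 + k) * (3 + k) * (3 * k + 8)
              ≡ (2 + k) * (3 + k) * (4 + k) * (3 * (1 + k) + 8)
  close = solve-∀

E-diag+3 : ∀ k → 48 * E k (3 + k) ≡ (1 + k) * (2 + k) * (3 + k) * (3 + k) * (4 + k) * (4 + k)
E-diag+3 zero    = refl
E-diag+3 (suc k) = begin
  48 * ((4 + k) * E (1 + k) (3 + k) + E k (3 + k))           ≡⟨ regroup k (E (1 + k) (3 + k)) (E k (3 + k)) ⟩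
  (4 + k) * 2 * (24 * E (1 + k) (3 + k)) + 48 * E k (3 + k)  ≡⟨ cong₂ (λ a b → (4 + k) * 2 * a + b) (E-diag+2 (suc k)) (E-diag+3 k) ⟩
  (4 + k) * 2 * ((2 + k) * (3 + k) * (4 + k) * (3 * (1 + k) + 8))
    + (1 + k) * (2 + k) * (3 + k) * (3 + k) * (4 + k) * (4 + k)
                                                             ≡⟨ close k ⟩
  (2 + k) * (3 + k) * (4 + k) * (4 + k) * (5 + k) * (5 + k)  ∎
  where
  regroup : ∀ k X Y → 48 * ((4 + k) * X + Y) ≡ (4 + k) * 2 * (24 * X) + 48 * Y
  regroup = solve-∀
  close : ∀ k → (4 + k) * 2 * ((2 + k) * (3 + k) * (4 + k) * (3 * (1 + k) + 8))
                  + (1 + k) * (2 + k) * (3 + k) * (3 + k) * (4 + k) * (4 + k)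
              ≡ (2 + k) * (3 + k) * (4 + k) * (4 + k) * (5 + k) * (5 + k)
  close = solve-∀

-- Lead p e x y : x ≡ p^e · y (mod p^(e+1)), i.e. the leading p-adic part of x
-- is p^e · y.
record Lead (p e x y : ℕ) : Set where
  constructor mkLead
  field
    quotient  : ℕ
    expansion : x ≡ p ^ e * (quotient * p + y)

module _ {p : ℕ} where

  lead-refl : ∀ x → Lead p 0 x x
  lead-refl x = mkLead 0 (sym (+-identityʳ x))

  lead-exponent : ∀ {e e′ x y} → e ≡ e′ → Lead p e x y → Lead p e′ x y
  lead-exponent {x = x} {y} = subst (λ e → Lead p e x y)

  lead-value : ∀ {e x y y′} → y ≡ y′ → Lead p e x y → Lead p e x y′
  lead-value {e} {x} = subst (Lead p e x)

  lead-+ : ∀ {e x x′ y y′} → Lead p e x y → Lead p e x′ y′ → Lead p e (x + x′) (y + y′)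
  lead-+ {e} {y = y} {y′} (mkLead q refl) (mkLead q′ refl) = mkLead (q + q′) (identity (p ^ e) p q q′ y y′)
    where
    identity : ∀ P p q q′ y y′ → P * (q * p + y) + P * (q′ * p + y′) ≡ P * ((q + q′) * p + (y + y′))
    identity = solve-∀

  lead-scale : ∀ c t {e x y} → Lead p e x y → Lead p e ((c + t * p) * x) (c * y)
  lead-scale c t {e} {y = y} (mkLead q refl) = mkLead (c * q + t * (q * p + y)) (identity (p ^ e) p c t q y)
    where
    identity : ∀ P p c t q y → (c + t * p) * (P * (q * p + y)) ≡ P * ((c * q + t * (q * p + y)) * p + c * y)
    identity = solve-∀

  lead-scale-p : ∀ t {e x y} → Lead p e x y → Lead p (suc e) ((t * p) * x) (t * y)
  lead-scale-p t {e} {y = y} (mkLead q refl) = mkLead (t * q) (identity (p ^ e) p t q y)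
    where
    identity : ∀ P p t q y → t * p * (P * (q * p + y)) ≡ p * P * (t * q * p + t * y)
    identity = solve-∀

  lead-multiple : ∀ t x → Lead p 0 (t * p * x) 0
  lead-multiple t x = mkLead (t * x) (identity p t x)
    where
    identity : ∀ p t x → t * p * x ≡ 1 * (t * x * p + 0)
    identity = solve-∀

  lead-drop : ∀ {e x y} → Lead p (suc e) x y → Lead p e x 0
  lead-drop {e} {y = y} (mkLead q refl) = mkLead (q * p + y) (identity (p ^ e) p q y)
    where
    identity : ∀ P p q y → p * P * (q * p + y) ≡ P * ((q * p + y) * p + 0)
    identity = solve-∀

  lead-pow-∣ : ∀ {e x y} → Lead p e x y → p ^ e ∣ x
  lead-pow-∣ {e} (mkLead q refl) = divides (q * p + _) (*-comm (p ^ e) _)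

  lead-vanishes : .{{_ : NonZero p}} → ∀ {e x y} → Lead p e x y → p ^ suc e ∣ x → p ∣ y
  lead-vanishes {e} {y = y} (mkLead q refl) p^[1+e]∣x = ∣m+n∣m⇒∣n p∣qp+y (n∣m*n q)
    where
    p∣qp+y : p ∣ q * p + y
    p∣qp+y = *-cancelˡ-∣ (p ^ e) {{m^n≢0 p e}} (subst (_∣ p ^ e * (q * p + y)) (*-comm p (p ^ e)) p^[1+e]∣x)

  pow-∣ : ∀ {a b} → a ≤ b → p ^ a ∣ p ^ b
  pow-∣ {a} {b} a≤b = divides (p ^ (b ∸ a)) (begin
    p ^ b             ≡⟨ cong (p ^_) (m∸n+n≡m a≤b) ⟨
    p ^ (b ∸ a + a)   ≡⟨ ^-distribˡ-+-* p (b ∸ a) a ⟩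
    p ^ (b ∸ a) * p ^ a ∎)

∤-* : ∀ {p a b} → Prime p → ¬ p ∣ a → ¬ p ∣ b → ¬ p ∣ a * b
∤-* {a = a} {b} prime-p p∤a p∤b p∣ab = [ p∤a , p∤b ]′ (euclidsLemma a b prime-p p∣ab)

∸-peel : ∀ {j m} → j < m → m ∸ j ≡ suc (m ∸ suc j)
∸-peel {zero}  {suc m} _         = refl
∸-peel {suc j} {suc m} (s≤s j<m) = ∸-peel j<m

-- The p-adic expansion of E along n = r + m·p.  Writing p = suc p′ makes
-- the successor of p′ + m·p definitionally (m+1)·p.
module PAdicExpansion {p′ : ℕ} (prime-p : Prime (suc p′)) where

  private
    p : ℕ
    p = suc p′

  Expansion : ℕ → ℕ → Set
  Expansion m r = Σ ℕ λ A → ¬ p ∣ A × (∀ {j} → j ≤ m → Lead p (m ∸ j) (E j (r + m * p)) (E j m * A))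

  expansion-start : Expansion 0 0
  expansion-start = 1 , >⇒∤ (nonTrivial⇒n>1 p {{prime⇒nonTrivial prime-p}}) , λ { z≤n → lead-refl 1 }

  -- r ↦ r + 1: the new factor r + 1 + m·p ≡ r + 1 is a unit.
  expansion-step : ∀ {m r} → suc r < p → Expansion m r → Expansion m (suc r)
  expansion-step {m} {r} r+1<p (A , p∤A , lead) = suc r * A , ∤-* prime-p (>⇒∤ r+1<p) p∤A , lead′
    where
    lead′ : ∀ {j} → j ≤ m → Lead p (m ∸ j) (E j (suc r + m * p)) (E j m * (suc r * A))
    lead′ {zero}  _   = lead-value (x∙yz≈y∙xz (suc r) (E 0 m) A) (lead-scale (suc r) m (lead z≤n))
    lead′ {suc j} j<m = lead-value (trans (+-identityʳ _) (x∙yz≈y∙xz (suc r) (E (suc j) m) A))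
      (lead-+ (lead-scale (suc r) m (lead j<m))
              (lead-drop (lead-exponent (∸-peel j<m) (lead (<⇒≤ j<m)))))

  -- (m, p − 1) ↦ (m + 1, 0): the new factor (m+1)·p reproduces the recursion
  -- E (j+1) (m+1) = (m+1) · E (j+1) m + E j m one p-adic order higher.
  expansion-carry : ∀ {m} → Expansion m p′ → Expansion (suc m) 0
  expansion-carry {m} (A , p∤A , lead) = A , p∤A , lead′
    where
    lead′ : ∀ {j} → j ≤ suc m → Lead p (suc m ∸ j) (E j (suc m * p)) (E j (suc m) * A)
    lead′ {zero}  _ = lead-value (sym (*-assoc (suc m) (E 0 m) A)) (lead-scale-p (suc m) (lead z≤n))
    lead′ {suc j} (s≤s j≤m) with m≤n⇒m<n∨m≡n j≤m
    ... | inj₁ j<m = lead-value (recursion (E (suc j) m) (E j m))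
      (lead-+ (lead-exponent (sym (∸-peel j<m)) (lead-scale-p (suc m) (lead j<m))) (lead j≤m))
      where
      recursion : ∀ X Y → suc m * (X * A) + Y * A ≡ (suc m * X + Y) * A
      recursion X Y = trans (cong (_+ Y * A) (sym (*-assoc (suc m) X A))) (sym (*-distribʳ-+ A (suc m * X) Y))
    ... | inj₂ refl = lead-value (cong (_* A) (trans (E-diag j) (sym (E-diag (suc j)))))
      (lead-+ (lead-exponent (sym (n∸n≡0 j)) (lead-multiple (suc j) (E (suc j) (p′ + j * p)))) (lead j≤m))

  expansion : ∀ m r → r < p → Expansion m r
  expansion zero    zero    _     = expansion-start
  expansion (suc m) zero    _     = expansion-carry (expansion m p′ ≤-refl)
  expansion m       (suc r) r+1<p = expansion-step r+1<p (expansion m r (<-trans (n<1+n r) r+1<p))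

  factorial-∤ : ∀ {k m r} → 0 < k → k ≤ m → r < p → ¬ p ∣ E k m → ¬ E 0 (r + m * p) ∣ E k (r + m * p)
  factorial-∤ {k} {m} {r} 0<k k≤m r<p p∤Ekm n!∣Ekn with expansion m r r<p
  ... | A , p∤A , lead = ∤-* prime-p p∤Ekm p∤A (lead-vanishes (lead k≤m) p^[m-k+1]∣Ekn)
    where
    p^[m-k+1]∣Ekn : p ^ suc (m ∸ k) ∣ E k (r + m * p)
    p^[m-k+1]∣Ekn = ∣-trans (pow-∣ (∸-monoʳ-< 0<k k≤m)) (∣-trans (lead-pow-∣ (lead z≤n)) n!∣Ekn)

-- Near the diagonal, p ∤ E k m as soon as p exceeds every factor of the
-- closed forms, i.e. p > k + 4 and p ∤ 3k + 8.
module NearDiagonal {p k : ℕ} (prime-p : Prime p) (k+4<p : k + 4 < p) (p∤3k+8 : ¬ p ∣ 3 * k + 8) where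

  private
    p∤small : ∀ i → i < 4 → ¬ p ∣ suc i + k
    p∤small i i<4 = >⇒∤ (≤-<-trans (subst (suc i + k ≤_) (+-comm 4 k) (+-monoˡ-≤ k i<4)) k+4<p)

    p∤1+k : ¬ p ∣ 1 + k
    p∤1+k = p∤small 0 (s≤s z≤n)
    p∤2+k : ¬ p ∣ 2 + k
    p∤2+k = p∤small 1 (s≤s (s≤s z≤n))
    p∤3+k : ¬ p ∣ 3 + k
    p∤3+k = p∤small 2 (s≤s (s≤s (s≤s z≤n)))
    p∤4+k : ¬ p ∣ 4 + k
    p∤4+k = p∤small 3 ≤-refl

    _∤×_ : ∀ {a b} → ¬ p ∣ a → ¬ p ∣ b → ¬ p ∣ a * b
    _∤×_ = ∤-* prime-p

    p∤E-diag+ : ∀ d → d < 4 → ¬ p ∣ E k (d + k)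
    p∤E-diag+ 0 _ p∣Ekk = >⇒∤ (nonTrivial⇒n>1 p {{prime⇒nonTrivial prime-p}}) (subst (p ∣_) (E-diag k) p∣Ekk)
    p∤E-diag+ 1 _ p∣E = (p∤1+k ∤× p∤2+k) (subst (p ∣_) (E-diag+1 k) (∣n⇒∣m*n 2 p∣E))
    p∤E-diag+ 2 _ p∣E = (((p∤1+k ∤× p∤2+k) ∤× p∤3+k) ∤× p∤3k+8) (subst (p ∣_) (E-diag+2 k) (∣n⇒∣m*n 24 p∣E))
    p∤E-diag+ 3 _ p∣E = (((((p∤1+k ∤× p∤2+k) ∤× p∤3+k) ∤× p∤3+k) ∤× p∤4+k) ∤× p∤4+k)
                          (subst (p ∣_) (E-diag+3 k) (∣n⇒∣m*n 48 p∣E))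
    p∤E-diag+ (suc (suc (suc (suc _)))) (s≤s (s≤s (s≤s (s≤s ()))))

  p∤E-near-diag : ∀ {m} → k ≤ m → m < 4 + k → ¬ p ∣ E k m
  p∤E-near-diag {m} k≤m m<4+k = subst (λ m → ¬ p ∣ E k m) (m∸n+n≡m k≤m)
    (p∤E-diag+ (m ∸ k) (+-cancelʳ-< k (m ∸ k) 4 (subst (_< 4 + k) (sym (m∸n+n≡m k≤m)) m<4+k)))

quotient-window : ∀ {n p k} .{{_ : NonZero p}} → p * k ≤ n → n < p * (4 + k) → k ≤ n / p × n / p < 4 + k
quotient-window {n} {p} {k} pk≤n n<p[4+k] =
  subst (_≤ n / p) (m*n/n≡m k p) (/-monoˡ-≤ p (subst (_≤ n) (*-comm p k) pk≤n)) ,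
  m<n*o⇒m/o<n (subst (n <_) (*-comm p (4 + k)) n<p[4+k])

module _ {a b c d : ℕ} where

  fromℚ-< : (a /ℕ suc b) <ℚ (c /ℕ suc d) → a * suc d < c * suc b
  fromℚ-< a/b<c/d with ℚᵘ.<-respʳ-≃ (ℚ.toℚᵘ-fromℚᵘ (mkℚᵘ (+ c) d))
                         (ℚᵘ.<-respˡ-≃ (ℚ.toℚᵘ-fromℚᵘ (mkℚᵘ (+ a) b)) (ℚ.toℚᵘ-mono-< a/b<c/d))
  ... | *<* lt = ℤ.drop‿+<+ (subst₂ ℤ._<_ (sym (ℤ.pos-* a (suc d))) (sym (ℤ.pos-* c (suc b))) lt)

  fromℚ-≤ : (a /ℕ suc b) ≤ℚ (c /ℕ suc d) → a * suc d ≤ c * suc b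
  fromℚ-≤ a/b≤c/d with ℚᵘ.≤-respʳ-≃ (ℚ.toℚᵘ-fromℚᵘ (mkℚᵘ (+ c) d))
                         (ℚᵘ.≤-respˡ-≃ (ℚ.toℚᵘ-fromℚᵘ (mkℚᵘ (+ a) b)) (ℚ.toℚᵘ-mono-≤ a/b≤c/d))
  ... | *≤* le = ℤ.drop‿+≤+ (subst₂ ℤ._≤_ (sym (ℤ.pos-* a (suc d))) (sym (ℤ.pos-* c (suc b))) le)

-- pred! n = n! − 1, the denominator field of n! in an unnormalised rational.
pred! : ℕ → ℕ
pred! zero    = 0
pred! (suc n) = n + suc n * pred! n

suc-pred!-step : ∀ n → suc (pred! (suc n)) ≡ suc n * suc (pred! n)
suc-pred!-step n = identity n (pred! n)
  where
  identity : ∀ n x → suc (n + suc n * x) ≡ suc n * suc x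
  identity = solve-∀

suc-pred! : ∀ n → suc (pred! n) ≡ E 0 n
suc-pred! zero    = refl
suc-pred! (suc n) = trans (suc-pred!-step n) (cong (suc n *_) (suc-pred! n))

_/! : ℕ → ℕ → ℚᵘ
(a /!) n = mkℚᵘ (+ a) (pred! n)

cross-≃ : ∀ {a b c d} → a * suc d ≡ c * suc b → mkℚᵘ (+ a) b ≃ mkℚᵘ (+ c) d
cross-≃ {a} {b} {c} {d} eq = *≡* (trans (sym (ℤ.pos-* a (suc d))) (trans (cong +_ eq) (ℤ.pos-* c (suc b))))

/!-recursion : ∀ n X Y → ((X /!) n ℚᵘ.+ mkℚᵘ (+ 1) n ℚᵘ.* (Y /!) n) ≃ ((suc n * X + Y) /!) (suc n)
/!-recursion n X Y = ℚᵘ.≃-trans (ℚᵘ.+-cong (ℚᵘ.≃-refl {(X /!) n}) product) (ℚᵘ.≃-trans sum (cross-≃ cross))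
  where
  f  = suc (pred! n)
  d₁ = pred! n + n * f
  d₂ = d₁ + pred! n * suc d₁
  product : (mkℚᵘ (+ 1) n ℚᵘ.* (Y /!) n) ≃ mkℚᵘ (+ (1 * Y)) d₁
  product = *≡* (cong (ℤ._* + suc d₁) (sym (ℤ.pos-* 1 Y)))
  sum : ((X /!) n ℚᵘ.+ mkℚᵘ (+ (1 * Y)) d₁) ≃ mkℚᵘ (+ (X * (suc n * f) + 1 * Y * f)) d₂
  sum = *≡* (cong (ℤ._* + suc d₂) (cong₂ ℤ._+_ (sym (ℤ.pos-* X (suc n * f))) (sym (ℤ.pos-* (1 * Y) f))))
  identity : ∀ s f X Y → (X * (s * f) + 1 * Y * f) * (s * f) ≡ (s * X + Y) * (f * (s * f))
  identity = solve-∀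
  cross : (X * (suc n * f) + 1 * Y * f) * suc (pred! (suc n)) ≡ (suc n * X + Y) * (f * (suc n * f))
  cross = trans (cong ((X * (suc n * f) + 1 * Y * f) *_) (suc-pred!-step n)) (identity (suc n) f X Y)

S-as-fraction : ∀ k n → ℚ.toℚᵘ (S k n) ≃ (E k n /!) n
S-as-fraction zero    n       = cross-≃ (trans (+-identityʳ _) (trans (suc-pred! n) (sym (*-identityʳ _))))
S-as-fraction (suc k) zero    = *≡* refl
S-as-fraction (suc k) (suc n) = begin-≃
  ℚ.toℚᵘ (S (suc k) n ℚ.+ (+ 1 ℚ./ suc n) ℚ.* S k n)
    ≈⟨ ℚ.toℚᵘ-homo-+ (S (suc k) n) _ ⟩
  ℚ.toℚᵘ (S (suc k) n) ℚᵘ.+ ℚ.toℚᵘ ((+ 1 ℚ./ suc n) ℚ.* S k n)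
    ≈⟨ ℚᵘ.+-cong (S-as-fraction (suc k) n)
         (ℚᵘ.≃-trans (ℚ.toℚᵘ-homo-* (+ 1 ℚ./ suc n) (S k n))
                     (ℚᵘ.*-cong (ℚ.toℚᵘ-fromℚᵘ (mkℚᵘ (+ 1) n)) (S-as-fraction k n))) ⟩
  (E (suc k) n /!) n ℚᵘ.+ mkℚᵘ (+ 1) n ℚᵘ.* (E k n /!) n
    ≈⟨ /!-recursion n (E (suc k) n) (E k n) ⟩
  (E (suc k) (suc n) /!) (suc n) ∎≃
  where open ℚᵘ.≃-Reasoning renaming (begin_ to begin-≃_; _∎ to _∎≃)

integral⇒factorial-∣ : ∀ {k n} → IsInteger (S k n) → E 0 n ∣ E k n
integral⇒factorial-∣ {k} {n} (z , S≡z) with ℚᵘ.≃-trans (ℚᵘ.≃-sym (S-as-fraction k n))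
                                              (ℚᵘ.≃-trans (ℚ.toℚᵘ-cong S≡z) (ℚ.toℚᵘ-fromℚᵘ (mkℚᵘ z 0)))
... | *≡* cross = divides ℤ.∣ z ∣ (begin
  E k n                          ≡⟨ *-identityʳ (E k n) ⟨
  E k n * 1                      ≡⟨ ℤ.abs-* (+ E k n) (+ 1) ⟨
  ℤ.∣ + E k n ℤ.* + 1 ∣          ≡⟨ cong ℤ.∣_∣ cross ⟩
  ℤ.∣ z ℤ.* + suc (pred! n) ∣    ≡⟨ ℤ.abs-* z _ ⟩
  ℤ.∣ z ∣ * suc (pred! n)        ≡⟨ cong (ℤ.∣ z ∣ *_) (suc-pred! n) ⟩
  ℤ.∣ z ∣ * E 0 n                ∎)

lemma4 : (k n : ℕ) → (k>1 : 1 < k) → k ≤ n →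
    Σ ℕ (λ p → Prime p × (n /ℕ (4 + k)) <ℚ (p /ℕ 1) × (p /ℕ 1) ≤ℚ divBy n k k>1 × k + 4 < p × ¬ (p ∣ 3 * k + 8)) →
    ¬ IsInteger (S k n)
lemma4 _ _ _ _ (zero , _ , _ , _ , () , _)
lemma4 k@(suc (suc k″)) n (s≤s (s≤s z≤n)) _ (suc p′ , prime-p , n/[k+4]<p , p≤n/k , k+4<p , p∤3k+8) S∈ℤ =
  factorial-∤ (s≤s z≤n) k≤m (m%n<n n p) p∤Ekm (subst (λ n → E 0 n ∣ E k n) n≡r+mp (integral⇒factorial-∣ {k} {n} S∈ℤ))
  where
  open PAdicExpansion prime-p using (factorial-∤)
  open NearDiagonal {k = k} prime-p k+4<p p∤3k+8 using (p∤E-near-diag)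
  p = suc p′
  m = n / p
  n≡r+mp : n ≡ n % p + m * p
  n≡r+mp = m≡m%n+[m/n]*n n p
  window : k ≤ m × m < 4 + k
  window = quotient-window (subst (p * k ≤_) (*-identityʳ n) (fromℚ-≤ {p} {0} {n} {suc k″} p≤n/k))
                           (subst (_< p * (4 + k)) (*-identityʳ n) (fromℚ-< {n} {3 + k} {p} {0} n/[k+4]<p))
  k≤m = proj₁ window
  p∤Ekm = p∤E-near-diag k≤m (proj₂ window)
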